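{- A proper, even set system $S$ is an even delta-matroid if and only if $S$ has no minor isomorphic to a set system in $\{(E,\mathcal{F})\in\mathcal{S}: |E|\text{ is even}\}\cup\mathcal{T}_{5,6,7}$.
   Context: A set system is a pair $S=(E,\mathcal{F})$ with $E$ finite and $\mathcal{F}$ a collection of subsets of $E$; it is proper if $\mathcal{F}\neq\emptyset$, even if $|X|-|Y|$ is even for all $X,Y\in\mathcal{F}$. Isomorphism: a bijection $\phi:E\to E'$ with $A\in\mathcal{F}\iff\phi(A)\in\mathcal{F}'$. For proper $S$ and $e\in E$: $e$ is a loop if no feasible set contains $e$, a coloop if every feasible set contains $e$. If $e$ is not a loop, $S/e=(E-e,\{F-e:e\in F\in\mathcal{F}\})$; if $e$ is not a coloop, $S\backslash e=(E-e,\{F\in\mathcal{F}:e\notin F\})$; if $e$ is a loop or coloop, $S/e$ and $S\backslash e$ are both set equal to whichever was defined. A minor is any set system obtained by a (possibly empty) sequence of such operations. Twist: $S*A=(E,\{F\triangle A:F\in\mathcal{F}\})$. A delta-matroid is a proper set system such that for all $X,Y\in\mathcal{F}$ and $u\in X\triangle Y$ there is $v\in X\triangle Y$ (possibly $v=u$) with $X\triangle\{u,v\}\in\mathcal{F}$; an even delta-matroid is a delta-matroid that is even. For $i\ge1$, $S_i=(\{e_1,\ldots,e_i\},\{\emptyset,\{e_1,\ldots,e_i\}\})$, and $\mathcal{S}$ is the set of all twists of $S_3,S_4,\ldots$. $T_5=(\{a,b,c,d\},\{\emptyset,\{a,b\},\{a,b,c,d\}\})$, $T_6=(\{a,b,c,d\},\{\emptyset,\{a,b\},\{a,c\},\{a,b,c,d\}\})$,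 $T_7=(\{a,b,c,d\},\{\emptyset,\{a,b\},\{a,c\},\{a,d\},\{a,b,c,d\}\})$, and $\mathcal{T}_{5,6,7}$ is the set of all twists of $T_5$, $T_6$, or $T_7$. -}

module Defs where

open import Data.Nat using (ℕ; suc; _≤_)
open import Data.Nat.Divisibility using () renaming (_∣_ to _∣ℕ_)
open import Data.Integer using (ℤ; +_; _-_)
open import Data.Integer.Divisibility using (_∣_)
open import Data.Bool using (Bool; true; false; _xor_; _∨_)
open import Data.Fin using (Fin; zero; suc)
open import Data.Fin.Subset using (Subset; _∈_; _∉_; ∣_∣; ⁅_⁆; _∪_; ⊥; ⊤)
open import Data.Vec using (Vec; []; _∷_; zipWith; insertAt; tabulate; lookup)
open import Data.Vec.Properties using (≡-dec)
open import Data.List using (List; []; _∷_)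
open import Data.Bool.ListAction using (any)
open import Data.Product using (Σ; Σ-syntax; ∃; ∃-syntax; _×_; _,_)
open import Data.Sum using (_⊎_)
open import Function.Bundles using (_↔_; Inverse)
open import Relation.Binary.PropositionalEquality using (_≡_)
open import Relation.Nullary using (¬_)
open import Relation.Nullary.Decidable using (⌊_⌋)
import Data.Bool.Properties as BoolP

-- A set system on the ground set E = Fin n: the family F of feasible sets is
-- given by its characteristic function on subsets of E.
SetSystem : ℕ → Set
SetSystem n = Subset n → Bool

Feasible : ∀ {n} → SetSystem n → Subset n → Set
Feasible S X = S X ≡ true

_△_ : ∀ {n} → Subset n → Subset n → Subset n
X △ Y = zipWith _xor_ X Y

Proper : ∀ {n} → SetSystem n → Set
Proper S = ∃[ X ] Feasible S X

EvenSS : ∀ {n} → SetSystem n → Set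
EvenSS S = ∀ X Y → Feasible S X → Feasible S Y → (+ 2) ∣ ((+ ∣ X ∣) - (+ ∣ Y ∣))

DeltaMatroid : ∀ {n} → SetSystem n → Set
DeltaMatroid {n} S =
  Proper S ×
  (∀ X Y → Feasible S X → Feasible S Y → (u : Fin n) → u ∈ (X △ Y) →
     ∃[ v ] (v ∈ (X △ Y) × Feasible S (X △ (⁅ u ⁆ ∪ ⁅ v ⁆))))

EvenDeltaMatroid : ∀ {n} → SetSystem n → Set
EvenDeltaMatroid S = DeltaMatroid S × EvenSS S

Loop : ∀ {n} → SetSystem n → Fin n → Set
Loop S e = ∀ X → Feasible S X → e ∉ X

Coloop : ∀ {n} → SetSystem n → Fin n → Set
Coloop S e = ∀ X → Feasible S X → e ∈ X

-- raw contraction / deletion: the ground set E - e is identified with Fin n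
-- via insertAt (element e of Fin (suc n) removed).
rawContract : ∀ {n} → SetSystem (suc n) → Fin (suc n) → SetSystem n
rawContract S e X = S (insertAt X e true)

rawDelete : ∀ {n} → SetSystem (suc n) → Fin (suc n) → SetSystem n
rawDelete S e X = S (insertAt X e false)

-- One minor operation (S/e or S\e), with the convention that for a loop
-- S/e := S\e and for a coloop S\e := S/e.
data MinorStep {n} (S : SetSystem (suc n)) : SetSystem n → Set where
  contract      : (e : Fin (suc n)) → ¬ Loop S e → MinorStep S (rawContract S e)
  contractLoop  : (e : Fin (suc n)) → Loop S e → MinorStep S (rawDelete S e)
  delete        : (e : Fin (suc n)) → ¬ Coloop S e → MinorStep S (rawDelete S e)
  deleteColoop  : (e : Fin (suc n)) → Coloop S e → MinorStep S (rawContract S e)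

data Minor : ∀ {m} → SetSystem m → ∀ {k} → SetSystem k → Set where
  here : ∀ {m} {S : SetSystem m} → Minor S S
  step : ∀ {n} {S : SetSystem (suc n)} {S' : SetSystem n} {k} {T : SetSystem k} →
         MinorStep S S' → Minor S' T → Minor S T

image : ∀ {m k} → Fin m ↔ Fin k → Subset m → Subset k
image φ A = tabulate (λ j → lookup A (Inverse.from φ j))

Iso : ∀ {m k} → SetSystem m → SetSystem k → Set
Iso {m} {k} S T = Σ[ φ ∈ Fin m ↔ Fin k ] (∀ A → S A ≡ T (image φ A))

-- twist S * A : feasible sets F △ A; X = F △ A iff F = X △ A
twist : ∀ {n} → SetSystem n → Subset n → SetSystem n
twist S A X = S (X △ A)

fromList : ∀ {n} → List (Subset n) → SetSystem n
fromList L X = any (λ F → ⌊ ≡-dec BoolP._≟_ X F ⌋) L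

Sys : (i : ℕ) → SetSystem i
Sys i = fromList (⊥ ∷ ⊤ ∷ [])

-- a = 0, b = 1, c = 2, d = 3
T5 T6 T7 : SetSystem 4
T5 = fromList (⊥ ∷ (true ∷ true ∷ false ∷ false ∷ []) ∷ ⊤ ∷ [])
T6 = fromList (⊥ ∷ (true ∷ true ∷ false ∷ false ∷ []) ∷ (true ∷ false ∷ true ∷ false ∷ []) ∷ ⊤ ∷ [])
T7 = fromList (⊥ ∷ (true ∷ true ∷ false ∷ false ∷ []) ∷ (true ∷ false ∷ true ∷ false ∷ [])
              ∷ (true ∷ false ∷ false ∷ true ∷ []) ∷ ⊤ ∷ [])

IsoToExcluded : ∀ {k} → SetSystem k → Set
IsoToExcluded M =
  (Σ[ i ∈ ℕ ] (3 ≤ i × 2 ∣ℕ i × Σ[ A ∈ Subset i ] Iso M (twist (Sys i) A)))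
  ⊎ (Σ[ A ∈ Subset 4 ] (Iso M (twist T5 A) ⊎ Iso M (twist T6 A) ⊎ Iso M (twist T7 A)))

HasExcludedMinor : ∀ {n} → SetSystem n → Set
HasExcludedMinor S = Σ[ k ∈ ℕ ] Σ[ M ∈ SetSystem k ] (Minor S M × IsoToExcluded M)

-- Each excluded system violates the exchange axiom, and a violation in a minor, in an
-- isomorphic copy or in a twist lifts to the original system; so delta-matroids have no
-- excluded minor. Conversely, let X, Y, u violate the exchange axiom with |X △ Y| minimal.
-- Twisting by X and removing everything outside D = X △ Y gives an even minor in which ∅ and D
-- are feasible, no pair {u,v} is, and exchange holds at every smaller distance. If ∅ and D are
-- its only feasible sets, it is S_|D| with |D| even and at least 3. Otherwise an intermediate
-- feasible set yields, by exchange from ∅, a feasible pair {p,q} avoiding u, and then, by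
-- exchange from {p,q} towards D, a feasible four-element set K = {p,q} △ {u,r}. Restricting to
-- K keeps the situation, and on four elements the feasible sets are ∅, K and pairs avoiding u:
-- up to relabelling, S_4 or a twist of T5, T6 or T7.

module Submission where

open import Defs
open import Data.Nat using (ℕ)
open import Function.Bundles using (_⇔_)
open import Relation.Nullary using (¬_)

open import Algebra.Bundles using (CommutativeRing)
import Algebra.Properties.CommutativeMonoid.Sum as MonoidSum
open import Data.Bool using (Bool; true; false; not; _xor_; _∨_)
open import Data.Bool.Properties as Bool
  using (xor-assoc; xor-comm; xor-identityˡ; xor-same; xor-∧-commutativeRing; not-involutive)
open import Data.Empty using (⊥-elim)
open import Data.Fin using (Fin; zero; suc; _≟_; punchIn)
open import Data.Fin.Patterns using (0F; 1F; 2F; 3F)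
open import Data.Fin.Permutation as Perm using (Permutation; _⟨$⟩ʳ_; _⟨$⟩ˡ_)
open import Data.Fin.Properties using (any?)
open import Data.Fin.Subset using (Subset; _∈_; ⁅_⁆; _∪_; ∣_∣; ⊥; ⊤)
open import Data.Fin.Subset.Properties
  using (anySubset?; nonempty?; Empty-unique; ∣⊤∣≡n; ∣p∣≤n; ∣p∣≡n⇒p≡⊤; ∣⁅x⁆∣≡1; x∈⁅y⁆⇒x≡y; ∪-idem; ∪-comm)
open import Data.Integer using (_⊖_)
import Data.Integer as ℤ
import Data.Integer.Properties as ℤ
open import Data.Nat as ℕ using (zero; suc; _<_; _≤_; z≤n; s≤s)
open import Data.Nat.Divisibility using (divides) renaming (_∣_ to _∣ℕ_)
open import Data.Nat.Properties using (≤∧≢⇒<; <-≤-trans; ≤-pred; n<1+n)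
open import Data.Product using (Σ-syntax; ∃-syntax; _×_; _,_; proj₁; proj₂; map₂)
open import Data.Sum using (_⊎_; inj₁; inj₂; [_,_])
open import Data.Vec using (Vec; []; _∷_; lookup; zipWith; insertAt)
open import Data.Vec.Properties
  using ([]=⇒lookup; lookup⇒[]=; ≡-dec; lookup-zipWith; lookup-replicate; lookup∘tabulate;
         tabulate∘lookup; tabulate-cong; insertAt-lookup; insertAt-punchIn;
         zipWith-assoc; zipWith-comm; zipWith-identityˡ; zipWith-identityʳ)
open import Function using (_∘_)
open import Function.Bundles using (Equivalence; mk⇔)
open import Relation.Binary.PropositionalEquality
  using (_≡_; _≢_; refl; sym; trans; cong; cong₂; subst; subst₂; module ≡-Reasoning)
open import Relation.Nullary using (Dec; yes; no; does)
open import Relation.Nullary.Decidable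
  using (True; toWitness; map′; _×-dec_; ¬?; dec-true; dec-false; does-⇔)

private variable
  m n k : ℕ

private
  true≢false : true ≢ false
  true≢false ()

lookup-extensional : {X Y : Subset n} → (∀ i → lookup X i ≡ lookup Y i) → X ≡ Y
lookup-extensional {X = X} {Y} eq =
  trans (sym (tabulate∘lookup X)) (trans (tabulate-cong eq) (tabulate∘lookup Y))

lookup-△ : (X Y : Subset n) (i : Fin n) → lookup (X △ Y) i ≡ lookup X i xor lookup Y i
lookup-△ X Y i = lookup-zipWith _xor_ i X Y

lookup-∪ : (X Y : Subset n) (i : Fin n) → lookup (X ∪ Y) i ≡ lookup X i ∨ lookup Y i
lookup-∪ X Y i = lookup-zipWith _∨_ i X Y

lookup-⊥ : (i : Fin n) → lookup ⊥ i ≡ false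
lookup-⊥ i = lookup-replicate i false

lookup-⊤ : (i : Fin n) → lookup ⊤ i ≡ true
lookup-⊤ i = lookup-replicate i true

lookup-⁅⁆ : (x y : Fin n) → lookup ⁅ x ⁆ y ≡ does (x ≟ y)
lookup-⁅⁆ zero    zero    = refl
lookup-⁅⁆ zero    (suc y) = lookup-⊥ y
lookup-⁅⁆ (suc x) zero    = refl
lookup-⁅⁆ (suc x) (suc y) = lookup-⁅⁆ x y

△-assoc : (X Y Z : Subset n) → (X △ Y) △ Z ≡ X △ (Y △ Z)
△-assoc = zipWith-assoc xor-assoc

△-comm : (X Y : Subset n) → X △ Y ≡ Y △ X
△-comm = zipWith-comm xor-comm

△-identityˡ : (X : Subset n) → ⊥ △ X ≡ X
△-identityˡ = zipWith-identityˡ xor-identityˡ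

△-identityʳ : (X : Subset n) → X △ ⊥ ≡ X
△-identityʳ = zipWith-identityʳ Bool.xor-identityʳ

△-self : (X : Subset n) → X △ X ≡ ⊥
△-self []      = refl
△-self (x ∷ X) = cong₂ _∷_ (xor-same x) (△-self X)

△-cancelʳ : (X A : Subset n) → (X △ A) △ A ≡ X
△-cancelʳ X A = begin
  (X △ A) △ A ≡⟨ △-assoc X A A ⟩
  X △ (A △ A) ≡⟨ cong (X △_) (△-self A) ⟩
  X △ ⊥       ≡⟨ △-identityʳ X ⟩
  X           ∎
  where open ≡-Reasoning

△-swapʳ : (X Y Z : Subset n) → (X △ Y) △ Z ≡ (X △ Z) △ Y
△-swapʳ X Y Z = begin
  (X △ Y) △ Z ≡⟨ △-assoc X Y Z ⟩
  X △ (Y △ Z) ≡⟨ cong (X △_) (△-comm Y Z) ⟩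
  X △ (Z △ Y) ≡⟨ △-assoc X Z Y ⟨
  (X △ Z) △ Y ∎
  where open ≡-Reasoning

△-cancel-common : (X Y A : Subset n) → (X △ A) △ (Y △ A) ≡ X △ Y
△-cancel-common X Y A = begin
  (X △ A) △ (Y △ A) ≡⟨ △-assoc (X △ A) Y A ⟨
  ((X △ A) △ Y) △ A ≡⟨ cong (_△ A) (△-swapʳ X A Y) ⟩
  ((X △ Y) △ A) △ A ≡⟨ △-cancelʳ (X △ Y) A ⟩
  X △ Y             ∎
  where open ≡-Reasoning

△-cancelˡ : (X Y : Subset n) → (X △ Y) △ X ≡ Y
△-cancelˡ X Y = trans (cong (_△ X) (△-comm X Y)) (△-cancelʳ Y X)

lookup-⁅⁆-self : (x : Fin n) → lookup ⁅ x ⁆ x ≡ true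
lookup-⁅⁆-self x = trans (lookup-⁅⁆ x x) (dec-true (x ≟ x) refl)

lookup-⁅⁆-≢ : {x y : Fin n} → x ≢ y → lookup ⁅ x ⁆ y ≡ false
lookup-⁅⁆-≢ {x = x} {y} x≢y = trans (lookup-⁅⁆ x y) (dec-false (x ≟ y) x≢y)

⁅⁆∪⁅⁆≡⁅⁆△⁅⁆ : {x y : Fin n} → x ≢ y → ⁅ x ⁆ ∪ ⁅ y ⁆ ≡ ⁅ x ⁆ △ ⁅ y ⁆
⁅⁆∪⁅⁆≡⁅⁆△⁅⁆ {x = x} {y} x≢y = lookup-extensional λ j → begin
  lookup (⁅ x ⁆ ∪ ⁅ y ⁆) j             ≡⟨ lookup-∪ ⁅ x ⁆ ⁅ y ⁆ j ⟩
  lookup ⁅ x ⁆ j ∨ lookup ⁅ y ⁆ j      ≡⟨ ∨≡xor (lookup ⁅ x ⁆ j) (lookup ⁅ y ⁆ j) (disjoint j) ⟩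
  lookup ⁅ x ⁆ j xor lookup ⁅ y ⁆ j    ≡⟨ lookup-△ ⁅ x ⁆ ⁅ y ⁆ j ⟨
  lookup (⁅ x ⁆ △ ⁅ y ⁆) j             ∎
  where
  open ≡-Reasoning
  ∨≡xor : ∀ a b → ¬ (a ≡ true × b ≡ true) → a ∨ b ≡ a xor b
  ∨≡xor true  true  a∧b = ⊥-elim (a∧b (refl , refl))
  ∨≡xor true  false _   = refl
  ∨≡xor false b     _   = refl
  disjoint : ∀ j → ¬ (lookup ⁅ x ⁆ j ≡ true × lookup ⁅ y ⁆ j ≡ true)
  disjoint j (j∈x , j∈y) = x≢y (trans (sym (x∈⁅y⁆⇒x≡y x (lookup⇒[]= j ⁅ x ⁆ j∈x)))
                                   (x∈⁅y⁆⇒x≡y y (lookup⇒[]= j ⁅ y ⁆ j∈y)))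

∉-△ : (A B : Subset n) {x : Fin n} → lookup A x ≡ false → lookup B x ≡ false → lookup (A △ B) x ≡ false
∉-△ A B {x} x∉A x∉B = trans (lookup-△ A B x) (cong₂ _xor_ x∉A x∉B)

∣△⁅⁆∣ : (A : Subset n) (x : Fin n) → lookup A x ≡ false → ∣ A △ ⁅ x ⁆ ∣ ≡ suc ∣ A ∣
∣△⁅⁆∣ (false ∷ A) zero    _   = cong (ℕ.suc ∘ ∣_∣) (△-identityʳ A)
∣△⁅⁆∣ (true ∷ A)  (suc x) x∉A = cong suc (∣△⁅⁆∣ A x x∉A)
∣△⁅⁆∣ (false ∷ A) (suc x) x∉A = ∣△⁅⁆∣ A x x∉A

≢⊤⇒∣∣< : {W : Subset n} → W ≢ ⊤ → ∣ W ∣ < n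
≢⊤⇒∣∣< {W = W} W≢⊤ = ≤∧≢⇒< (∣p∣≤n W) (W≢⊤ ∘ ∣p∣≡n⇒p≡⊤ {p = W})

∉⇒∣∣< : (W : Subset n) {x : Fin n} → lookup W x ≡ false → ∣ W ∣ < n
∉⇒∣∣< W {x} x∉W = ≢⊤⇒∣∣< {W = W} λ { refl → true≢false (trans (sym (lookup-⊤ x)) x∉W) }

lookup-△-⊤ : (A : Subset n) (x : Fin n) → lookup (A △ ⊤) x ≡ not (lookup A x)
lookup-△-⊤ A x = trans (lookup-△ A ⊤ x) (trans (cong (lookup A x xor_) (lookup-⊤ x)) (xor-comm _ true))

≢⊥⇒element : {W : Subset n} → W ≢ ⊥ → ∃[ x ] lookup W x ≡ true
≢⊥⇒element {W = W} W≢⊥ with nonempty? W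
... | yes (x , x∈W) = x , []=⇒lookup x∈W
... | no W-empty    = ⊥-elim (W≢⊥ (Empty-unique W-empty))

module _ (φ : Permutation m k) where

  lookup-image : (A : Subset m) (j : Fin k) → lookup (image φ A) j ≡ lookup A (φ ⟨$⟩ˡ j)
  lookup-image A j = lookup∘tabulate _ j

  image-△ : (A B : Subset m) → image φ (A △ B) ≡ image φ A △ image φ B
  image-△ A B = lookup-extensional λ j → begin
    lookup (image φ (A △ B)) j                         ≡⟨ lookup-image (A △ B) j ⟩
    lookup (A △ B) (φ ⟨$⟩ˡ j)                          ≡⟨ lookup-△ A B _ ⟩
    lookup A (φ ⟨$⟩ˡ j) xor lookup B (φ ⟨$⟩ˡ j)        ≡⟨ cong₂ _xor_ (lookup-image A j) (lookup-image B j) ⟨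
    lookup (image φ A) j xor lookup (image φ B) j      ≡⟨ lookup-△ (image φ A) (image φ B) j ⟨
    lookup (image φ A △ image φ B) j                   ∎
    where open ≡-Reasoning

  image-∪ : (A B : Subset m) → image φ (A ∪ B) ≡ image φ A ∪ image φ B
  image-∪ A B = lookup-extensional λ j → begin
    lookup (image φ (A ∪ B)) j                       ≡⟨ lookup-image (A ∪ B) j ⟩
    lookup (A ∪ B) (φ ⟨$⟩ˡ j)                        ≡⟨ lookup-∪ A B _ ⟩
    lookup A (φ ⟨$⟩ˡ j) ∨ lookup B (φ ⟨$⟩ˡ j)        ≡⟨ cong₂ _∨_ (lookup-image A j) (lookup-image B j) ⟨
    lookup (image φ A) j ∨ lookup (image φ B) j      ≡⟨ lookup-∪ (image φ A) (image φ B) j ⟨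
    lookup (image φ A ∪ image φ B) j                 ∎
    where open ≡-Reasoning

  image-⁅⁆ : (x : Fin m) → image φ ⁅ x ⁆ ≡ ⁅ φ ⟨$⟩ʳ x ⁆
  image-⁅⁆ x = lookup-extensional λ j → begin
    lookup (image φ ⁅ x ⁆) j        ≡⟨ lookup-image ⁅ x ⁆ j ⟩
    lookup ⁅ x ⁆ (φ ⟨$⟩ˡ j)         ≡⟨ lookup-⁅⁆ x _ ⟩
    does (x ≟ φ ⟨$⟩ˡ j)             ≡⟨ does-⇔ x≡φ⁻¹j⇔φx≡j (x ≟ _) (_ ≟ j) ⟩
    does (φ ⟨$⟩ʳ x ≟ j)             ≡⟨ lookup-⁅⁆ (φ ⟨$⟩ʳ x) j ⟨
    lookup ⁅ φ ⟨$⟩ʳ x ⁆ j           ∎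
    where
    open ≡-Reasoning
    x≡φ⁻¹j⇔φx≡j : ∀ {j} → x ≡ φ ⟨$⟩ˡ j ⇔ φ ⟨$⟩ʳ x ≡ j
    x≡φ⁻¹j⇔φx≡j = mk⇔ (λ { refl → Perm.inverseʳ φ }) (λ { refl → sym (Perm.inverseˡ φ) })

  lookup-image-△ : (X Y : Subset m) (v : Fin k) →
                   lookup (image φ X △ image φ Y) v ≡ lookup (X △ Y) (φ ⟨$⟩ˡ v)
  lookup-image-△ X Y v = trans (cong (λ D → lookup D v) (sym (image-△ X Y))) (lookup-image (X △ Y) v)

  image-pair : (u v : Fin m) → image φ (⁅ u ⁆ ∪ ⁅ v ⁆) ≡ ⁅ φ ⟨$⟩ʳ u ⁆ ∪ ⁅ φ ⟨$⟩ʳ v ⁆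
  image-pair u v = trans (image-∪ ⁅ u ⁆ ⁅ v ⁆) (cong₂ _∪_ (image-⁅⁆ u) (image-⁅⁆ v))

  image-exchanged : (X : Subset m) (u v : Fin m) →
                    image φ (X △ (⁅ u ⁆ ∪ ⁅ v ⁆)) ≡ image φ X △ (⁅ φ ⟨$⟩ʳ u ⁆ ∪ ⁅ φ ⟨$⟩ʳ v ⁆)
  image-exchanged X u v = trans (image-△ X _) (cong (image φ X △_) (image-pair u v))

  image-⊥ : image φ ⊥ ≡ ⊥
  image-⊥ = lookup-extensional λ j → trans (lookup-image ⊥ j) (trans (lookup-⊥ (φ ⟨$⟩ˡ j)) (sym (lookup-⊥ j)))

  image-⊤ : image φ ⊤ ≡ ⊤
  image-⊤ = lookup-extensional λ j → trans (lookup-image ⊤ j) (trans (lookup-⊤ (φ ⟨$⟩ˡ j)) (sym (lookup-⊤ j)))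

  image-flip : (A : Subset m) → image (Perm.flip φ) (image φ A) ≡ A
  image-flip A = lookup-extensional λ i → begin
    lookup (image (Perm.flip φ) (image φ A)) i ≡⟨ lookup∘tabulate _ i ⟩
    lookup (image φ A) (φ ⟨$⟩ʳ i)              ≡⟨ lookup-image A _ ⟩
    lookup A (φ ⟨$⟩ˡ (φ ⟨$⟩ʳ i))               ≡⟨ cong (lookup A) (Perm.inverseˡ φ) ⟩
    lookup A i                                 ∎
    where open ≡-Reasoning

image-id : (A : Subset n) → image Perm.id A ≡ A
image-id A = tabulate∘lookup A

image-∘ : (φ : Permutation m k) (ψ : Permutation k n) (A : Subset m) →
          image (φ Perm.∘ₚ ψ) A ≡ image ψ (image φ A)
image-∘ φ ψ A = lookup-extensional λ j → begin
  lookup (image (φ Perm.∘ₚ ψ) A) j      ≡⟨ lookup-image (φ Perm.∘ₚ ψ) A j ⟩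
  lookup A (φ ⟨$⟩ˡ (ψ ⟨$⟩ˡ j))          ≡⟨ lookup-image φ A _ ⟨
  lookup (image φ A) (ψ ⟨$⟩ˡ j)         ≡⟨ lookup-image ψ (image φ A) j ⟨
  lookup (image ψ (image φ A)) j        ∎
  where open ≡-Reasoning

-- Parity

private
  open module XorSum =
    MonoidSum (CommutativeRing.+-commutativeMonoid xor-∧-commutativeRing)
    using (sum; sum-cong-≗; ∑-distrib-+; sum-permute)

parity : Subset n → Bool
parity A = sum (lookup A)

parity-△ : (A B : Subset n) → parity (A △ B) ≡ parity A xor parity B
parity-△ A B = trans (sum-cong-≗ (lookup-△ A B)) (∑-distrib-+ (lookup A) (lookup B))

parity-⊥ : parity (⊥ {n}) ≡ false
parity-⊥ {zero}  = refl
parity-⊥ {suc n} = parity-⊥ {n}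

parity-⁅⁆ : (x : Fin n) → parity ⁅ x ⁆ ≡ true
parity-⁅⁆ {suc n} zero = cong not (parity-⊥ {n})
parity-⁅⁆ (suc x) = parity-⁅⁆ x

parity-⁅⁆∪⁅⁆ : (x : Fin n) → parity (⁅ x ⁆ ∪ ⁅ x ⁆) ≡ true
parity-⁅⁆∪⁅⁆ x = trans (cong parity (∪-idem ⁅ x ⁆)) (parity-⁅⁆ x)

parity-image : (φ : Permutation m k) (A : Subset m) → parity (image φ A) ≡ parity A
parity-image φ A = begin
  parity (image φ A)                    ≡⟨ sum-cong-≗ (lookup-image φ A) ⟩
  sum (λ j → lookup A (φ ⟨$⟩ˡ j))       ≡⟨ sum-permute (lookup A) (Perm.flip φ) ⟨
  parity A                              ∎
  where open ≡-Reasoning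

parityℕ : ℕ → Bool
parityℕ zero    = false
parityℕ (suc n) = not (parityℕ n)

parity≡parityℕ∣∣ : (A : Subset n) → parity A ≡ parityℕ ∣ A ∣
parity≡parityℕ∣∣ []          = refl
parity≡parityℕ∣∣ (true ∷ A)  = cong not (parity≡parityℕ∣∣ A)
parity≡parityℕ∣∣ (false ∷ A) = parity≡parityℕ∣∣ A

parityℕ-double : ∀ q → parityℕ (q ℕ.* 2) ≡ false
parityℕ-double zero    = refl
parityℕ-double (suc q) = trans (not-involutive _) (parityℕ-double q)

2∣⇒parityℕ≡false : ∀ {a} → 2 ∣ℕ a → parityℕ a ≡ false
2∣⇒parityℕ≡false (divides q refl) = parityℕ-double q

parityℕ≡false⇒2∣ : ∀ a → parityℕ a ≡ false → 2 ∣ℕ a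
parityℕ≡false⇒2∣ zero          _ = divides 0 refl
parityℕ≡false⇒2∣ (suc zero)    ()
parityℕ≡false⇒2∣ (suc (suc a)) p with parityℕ≡false⇒2∣ a (trans (sym (not-involutive _)) p)
... | divides q refl = divides (suc q) refl

2∣⊖⇒parityℕ≡ : ∀ a b → 2 ∣ℕ ℤ.∣ a ⊖ b ∣ → parityℕ a ≡ parityℕ b
2∣⊖⇒parityℕ≡ zero    zero    _ = refl
2∣⊖⇒parityℕ≡ (suc a) zero    d = 2∣⇒parityℕ≡false d
2∣⊖⇒parityℕ≡ zero    (suc b) d = sym (2∣⇒parityℕ≡false d)
2∣⊖⇒parityℕ≡ (suc a) (suc b) d =
  cong not (2∣⊖⇒parityℕ≡ a b (subst (λ z → 2 ∣ℕ ℤ.∣ z ∣) (ℤ.[1+m]⊖[1+n]≡m⊖n a b) d))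

even⇒parity≡ : {S : SetSystem n} → EvenSS S → ∀ {X Y} → Feasible S X → Feasible S Y →
              parity X ≡ parity Y
even⇒parity≡ {S = S} even {X} {Y} fX fY = begin
  parity X        ≡⟨ parity≡parityℕ∣∣ X ⟩
  parityℕ ∣ X ∣   ≡⟨ 2∣⊖⇒parityℕ≡ ∣ X ∣ ∣ Y ∣ 2∣∣X∣⊖∣Y∣ ⟩
  parityℕ ∣ Y ∣   ≡⟨ parity≡parityℕ∣∣ Y ⟨
  parity Y        ∎
  where
  open ≡-Reasoning
  2∣∣X∣⊖∣Y∣ = subst (λ z → 2 ∣ℕ ℤ.∣ z ∣) (ℤ.m-n≡m⊖n ∣ X ∣ ∣ Y ∣) (even X Y fX fY)

private
  xor≡ʳ⇒false : ∀ a b → a xor b ≡ b → a ≡ false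
  xor≡ʳ⇒false false b _  = refl
  xor≡ʳ⇒false true  b eq = ⊥-elim (Bool.not-¬ refl (sym eq))

twist-even : {S : SetSystem n} → EvenSS S → ∀ {X W} → Feasible S X → Feasible (twist S X) W → parity W ≡ false
twist-even even {X} {W} fX fW =
  xor≡ʳ⇒false (parity W) (parity X) (trans (sym (parity-△ W X)) (even⇒parity≡ even fW fX))

-- Exchange failures

Exchange : SetSystem n → Subset n → Subset n → Fin n → Set
Exchange S X Y u = ∃[ v ] (lookup (X △ Y) v ≡ true × Feasible S (X △ (⁅ u ⁆ ∪ ⁅ v ⁆)))

exchange? : (S : SetSystem n) (X Y : Subset n) (u : Fin n) → Dec (Exchange S X Y u)
exchange? S X Y u =
  any? λ v → (lookup (X △ Y) v Bool.≟ true) ×-dec (S (X △ (⁅ u ⁆ ∪ ⁅ v ⁆)) Bool.≟ true)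

record ExchangeFailure (S : SetSystem n) : Set where
  field
    X Y         : Subset n
    u           : Fin n
    X-feasible  : Feasible S X
    Y-feasible  : Feasible S Y
    u∈X△Y       : lookup (X △ Y) u ≡ true
    no-exchange : ¬ Exchange S X Y u

exchange⇔∃∈ : (S : SetSystem n) {X Y : Subset n} (u : Fin n) →
              Exchange S X Y u ⇔ (∃[ v ] (v ∈ X △ Y × Feasible S (X △ (⁅ u ⁆ ∪ ⁅ v ⁆))))
exchange⇔∃∈ S u = mk⇔ (λ (v , v∈ , feasible) → v , lookup⇒[]= v _ v∈ , feasible)
                  (λ (v , v∈ , feasible) → v , []=⇒lookup v∈ , feasible)

deltaMatroid⇒¬failure : {S : SetSystem n} → DeltaMatroid S → ¬ ExchangeFailure S
deltaMatroid⇒¬failure {S = S} (_ , exchange) f =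
  no-exchange (Equivalence.from (exchange⇔∃∈ S u)
                 (exchange X Y X-feasible Y-feasible u (lookup⇒[]= u _ u∈X△Y)))
  where open ExchangeFailure f

module _ (S : SetSystem n) (A : Subset n) {X Y : Subset n} {u : Fin n} where

  exchange-twist⁺ : Exchange S (X △ A) (Y △ A) u → Exchange (twist S A) X Y u
  exchange-twist⁺ (v , v∈ , feasible) =
      v
    , subst (λ D → lookup D v ≡ true) (△-cancel-common X Y A) v∈
    , subst (Feasible S) (△-swapʳ X A _) feasible

  exchange-twist⁻ : Exchange (twist S A) X Y u → Exchange S (X △ A) (Y △ A) u
  exchange-twist⁻ (v , v∈ , feasible) =
      v
    , subst (λ D → lookup D v ≡ true) (sym (△-cancel-common X Y A)) v∈
    , subst (Feasible S) (△-swapʳ X _ A) feasible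

failure-twist : {T : SetSystem n} (A : Subset n) → ExchangeFailure T → ExchangeFailure (twist T A)
failure-twist {T = T} A f = record
  { X           = X △ A
  ; Y           = Y △ A
  ; u           = u
  ; X-feasible  = subst (Feasible T) (sym (△-cancelʳ X A)) X-feasible
  ; Y-feasible  = subst (Feasible T) (sym (△-cancelʳ Y A)) Y-feasible
  ; u∈X△Y       = subst (λ D → lookup D u ≡ true) (sym (△-cancel-common X Y A)) u∈X△Y
  ; no-exchange = no-exchange ∘ subst₂ (λ X Y → Exchange T X Y u) (△-cancelʳ X A) (△-cancelʳ Y A)
                              ∘ exchange-twist⁻ T A
  }
  where open ExchangeFailure f

insertAt-zipWith : {A : Set} (f : A → A → A) (X Y : Vec A n) (e : Fin (suc n)) (a b : A) →
                   zipWith f (insertAt X e a) (insertAt Y e b) ≡ insertAt (zipWith f X Y) e (f a b)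
insertAt-zipWith f X       Y       zero    a b = refl
insertAt-zipWith f (x ∷ X) (y ∷ Y) (suc e) a b = cong (f x y ∷_) (insertAt-zipWith f X Y e a b)

insertAt-⊥ : (e : Fin (suc n)) → insertAt ⊥ e false ≡ ⊥
insertAt-⊥ zero            = refl
insertAt-⊥ {suc n} (suc e) = cong (false ∷_) (insertAt-⊥ e)

⁅punchIn⁆ : (e : Fin (suc n)) (x : Fin n) → ⁅ punchIn e x ⁆ ≡ insertAt ⁅ x ⁆ e false
⁅punchIn⁆ zero    x       = refl
⁅punchIn⁆ (suc e) zero    = cong (true ∷_) (sym (insertAt-⊥ e))
⁅punchIn⁆ (suc e) (suc x) = cong (false ∷_) (⁅punchIn⁆ e x)

insertAt-false-support : (W : Subset n) (e v : Fin (suc n)) → lookup (insertAt W e false) v ≡ true →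
                         ∃[ w ] (punchIn e w ≡ v × lookup W w ≡ true)
insertAt-false-support W       zero    (suc v) w∈ = v , refl , w∈
insertAt-false-support (w ∷ W) (suc e) zero    w∈ = zero , refl , w∈
insertAt-false-support (w ∷ W) (suc e) (suc v) w∈ with insertAt-false-support W e v w∈
... | w , refl , w∈W = suc w , refl , w∈W

insertAt-△ : (X Y : Subset n) (e : Fin (suc n)) (b : Bool) →
             insertAt X e b △ insertAt Y e b ≡ insertAt (X △ Y) e false
insertAt-△ X Y e b = trans (insertAt-zipWith _xor_ X Y e b b) (cong (insertAt (X △ Y) e) (xor-same b))

insertAt-exchanged : (X : Subset n) (e : Fin (suc n)) (b : Bool) (u w : Fin n) →
                     insertAt X e b △ (⁅ punchIn e u ⁆ ∪ ⁅ punchIn e w ⁆) ≡ insertAt (X △ (⁅ u ⁆ ∪ ⁅ w ⁆)) e b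
insertAt-exchanged X e b u w = begin
  insertAt X e b △ (⁅ punchIn e u ⁆ ∪ ⁅ punchIn e w ⁆)
    ≡⟨ cong₂ (λ P Q → insertAt X e b △ (P ∪ Q)) (⁅punchIn⁆ e u) (⁅punchIn⁆ e w) ⟩
  insertAt X e b △ (insertAt ⁅ u ⁆ e false ∪ insertAt ⁅ w ⁆ e false)
    ≡⟨ cong (insertAt X e b △_) (insertAt-zipWith _∨_ ⁅ u ⁆ ⁅ w ⁆ e false false) ⟩
  insertAt X e b △ insertAt (⁅ u ⁆ ∪ ⁅ w ⁆) e false
    ≡⟨ insertAt-zipWith _xor_ X _ e b false ⟩
  insertAt (X △ (⁅ u ⁆ ∪ ⁅ w ⁆)) e (b xor false)
    ≡⟨ cong (insertAt _ e) (Bool.xor-identityʳ b) ⟩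
  insertAt (X △ (⁅ u ⁆ ∪ ⁅ w ⁆)) e b ∎
  where open ≡-Reasoning

module _ (S : SetSystem (suc n)) (e : Fin (suc n)) (b : Bool) where

  exchange-insertAt⁻ : ∀ {X Y u} → Exchange S (insertAt X e b) (insertAt Y e b) (punchIn e u) →
                       Exchange (λ Z → S (insertAt Z e b)) X Y u
  exchange-insertAt⁻ {X} {Y} {u} (v , v∈ , feasible)
    with insertAt-false-support (X △ Y) e v (subst (λ D → lookup D v ≡ true) (insertAt-△ X Y e b) v∈)
  ... | w , refl , w∈ = w , w∈ , subst (Feasible S) (insertAt-exchanged X e b u w) feasible

  failure-insertAt : ExchangeFailure (λ Z → S (insertAt Z e b)) → ExchangeFailure S
  failure-insertAt f = record
    { X           = insertAt X e b
    ; Y           = insertAt Y e b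
    ; u           = punchIn e u
    ; X-feasible  = X-feasible
    ; Y-feasible  = Y-feasible
    ; u∈X△Y       = trans (cong (λ D → lookup D (punchIn e u)) (insertAt-△ X Y e b))
                          (trans (insertAt-punchIn (X △ Y) e false u) u∈X△Y)
    ; no-exchange = no-exchange ∘ exchange-insertAt⁻
    }
    where open ExchangeFailure f

failure-minor : {S : SetSystem m} {T : SetSystem k} → Minor S T → ExchangeFailure T → ExchangeFailure S
failure-minor here                              f = f
failure-minor (step {S = S} (contract e _)     M) f = failure-insertAt S e true  (failure-minor M f)
failure-minor (step {S = S} (contractLoop e _) M) f = failure-insertAt S e false (failure-minor M f)
failure-minor (step {S = S} (delete e _)       M) f = failure-insertAt S e false (failure-minor M f)
failure-minor (step {S = S} (deleteColoop e _) M) f = failure-insertAt S e true  (failure-minor M f)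

failure-iso : {S : SetSystem m} {T : SetSystem k} → Iso S T → ExchangeFailure S → ExchangeFailure T
failure-iso {T = T} (φ , S≡T∘φ) f = record
  { X           = image φ X
  ; Y           = image φ Y
  ; u           = φ ⟨$⟩ʳ u
  ; X-feasible  = trans (sym (S≡T∘φ X)) X-feasible
  ; Y-feasible  = trans (sym (S≡T∘φ Y)) Y-feasible
  ; u∈X△Y       = trans (lookup-image-△ φ X Y _) (trans (cong (lookup (X △ Y)) (Perm.inverseˡ φ)) u∈X△Y)
  ; no-exchange = λ (v , v∈ , feasible) → no-exchange
      ( φ ⟨$⟩ˡ v
      , trans (sym (lookup-image-△ φ X Y v)) v∈
      , trans (S≡T∘φ _) (subst (Feasible T) (sym (moved v)) feasible))
  }
  where
  open ExchangeFailure f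
  moved : ∀ v → image φ (X △ (⁅ u ⁆ ∪ ⁅ φ ⟨$⟩ˡ v ⁆)) ≡ image φ X △ (⁅ φ ⟨$⟩ʳ u ⁆ ∪ ⁅ v ⁆)
  moved v = trans (image-exchanged φ X u _)
                  (cong (λ w → image φ X △ (⁅ φ ⟨$⟩ʳ u ⁆ ∪ ⁅ w ⁆)) (Perm.inverseʳ φ))

-- Isomorphism and twisting

Iso-≗ : {S T : SetSystem n} → (∀ A → S A ≡ T A) → Iso S T
Iso-≗ {T = T} S≗T = Perm.id , λ A → trans (S≗T A) (cong T (sym (image-id A)))

Iso-sym : {S : SetSystem m} {T : SetSystem k} → Iso S T → Iso T S
Iso-sym {T = T} (φ , S≡T∘φ) =
  Perm.flip φ , λ B → trans (cong T (sym (image-flip (Perm.flip φ) B))) (sym (S≡T∘φ _))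

Iso-trans : {S : SetSystem m} {T : SetSystem k} {U : SetSystem n} → Iso S T → Iso T U → Iso S U
Iso-trans {U = U} (φ , S≡T∘φ) (ψ , T≡U∘ψ) =
  φ Perm.∘ₚ ψ , λ A → trans (S≡T∘φ A) (trans (T≡U∘ψ _) (cong U (sym (image-∘ φ ψ A))))

Iso-twist : {S : SetSystem m} {T : SetSystem k} (A : Subset m) →
            (iso : Iso S T) → Iso (twist S A) (twist T (image (proj₁ iso) A))
Iso-twist {T = T} A (φ , S≡T∘φ) = φ , λ X → trans (S≡T∘φ (X △ A)) (cong T (image-△ φ X A))

twist-twist : (T : SetSystem n) (B C X : Subset n) → twist (twist T B) C X ≡ twist T (C △ B) X
twist-twist T B C X = cong T (△-assoc X C B)

private
  TwistIso : SetSystem m → SetSystem k → Set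
  TwistIso {k = k} S T = Σ[ A ∈ Subset k ] Iso S (twist T A)

  excluded-map : {S : SetSystem m} {S′ : SetSystem n} →
                 (∀ {k} {T : SetSystem k} → TwistIso S T → TwistIso S′ T) →
                 IsoToExcluded S → IsoToExcluded S′
  excluded-map f (inj₁ (i , 3≤i , 2∣i , t)) = inj₁ (i , 3≤i , 2∣i , f {T = Sys i} t)
  excluded-map f (inj₂ (A , inj₁ iso))        = inj₂ (map₂ inj₁ (f {T = T5} (A , iso)))
  excluded-map f (inj₂ (A , inj₂ (inj₁ iso))) = inj₂ (map₂ (inj₂ ∘ inj₁) (f {T = T6} (A , iso)))
  excluded-map f (inj₂ (A , inj₂ (inj₂ iso))) = inj₂ (map₂ (inj₂ ∘ inj₂) (f {T = T7} (A , iso)))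

excluded-iso : {S : SetSystem m} {S′ : SetSystem n} → Iso S S′ → IsoToExcluded S′ → IsoToExcluded S
excluded-iso {S′ = S′} S≅S′ = excluded-map λ { {T = T} (A , S′≅T*A) →
  A , Iso-trans {T = S′} {U = twist T A} S≅S′ S′≅T*A }

excluded-≗ : {S S′ : SetSystem n} → (∀ A → S A ≡ S′ A) → IsoToExcluded S′ → IsoToExcluded S
excluded-≗ S≗S′ = excluded-iso (Iso-≗ S≗S′)

excluded-twist : {S : SetSystem n} (C : Subset n) → IsoToExcluded S → IsoToExcluded (twist S C)
excluded-twist C = excluded-map λ { {T = T} (A , S≅T*A) →
  let C′ = image (proj₁ S≅T*A) C in
  C′ △ A , Iso-trans {T = twist (twist T A) C′} {U = twist T (C′ △ A)}
                     (Iso-twist {T = twist T A} C S≅T*A) (Iso-≗ (twist-twist T A C′)) }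

excluded-untwist : {S : SetSystem n} (C : Subset n) → IsoToExcluded (twist S C) → IsoToExcluded S
excluded-untwist {S = S} C =
  excluded-≗ (λ X → cong S (sym (△-cancelʳ X C))) ∘ excluded-twist C

Sys-excluded : ∀ {i} → 3 ≤ i → 2 ∣ℕ i → IsoToExcluded (Sys i)
Sys-excluded {i} 3≤i 2∣i = inj₁ (i , 3≤i , 2∣i , ⊥ , Iso-≗ λ W → cong (Sys i) (sym (△-identityʳ W)))

-- The excluded set systems are not delta-matroids

Sys-feasible⁺ : ∀ {i} {W : Subset i} → W ≡ ⊥ ⊎ W ≡ ⊤ → Feasible (Sys i) W
Sys-feasible⁺ {W = W} W∈ with ≡-dec Bool._≟_ W ⊥ | ≡-dec Bool._≟_ W ⊤
... | yes _   | _       = refl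
... | no _    | yes _   = refl
... | no W≢⊥  | no W≢⊤  = ⊥-elim ([ W≢⊥ , W≢⊤ ] W∈)

Sys-feasible⁻ : ∀ {i} {W : Subset i} → Feasible (Sys i) W → W ≡ ⊥ ⊎ W ≡ ⊤
Sys-feasible⁻ {W = W} feasible with ≡-dec Bool._≟_ W ⊥ | ≡-dec Bool._≟_ W ⊤
... | yes W≡⊥ | _       = inj₁ W≡⊥
... | no _    | yes W≡⊤ = inj₂ W≡⊤
... | no _    | no _    = ⊥-elim (true≢false (sym feasible))

Sys-failure : ∀ i → ExchangeFailure (Sys (3 ℕ.+ i))
Sys-failure i = record
  { X           = ⊥
  ; Y           = ⊤
  ; u           = 0F
  ; X-feasible  = Sys-feasible⁺ {3 ℕ.+ i} (inj₁ refl)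
  ; Y-feasible  = Sys-feasible⁺ {3 ℕ.+ i} (inj₂ refl)
  ; u∈X△Y       = refl
  ; no-exchange = λ (v , _ , feasible) → neither-⊥-nor-⊤ v (Sys-feasible⁻ feasible)
  }
  where
  at : ∀ {W W′ : Subset (3 ℕ.+ i)} → W ≡ W′ → ∀ j → lookup W j ≡ lookup W′ j
  at eq j = cong (λ W → lookup W j) eq
  neither-⊥-nor-⊤ : ∀ v → ¬ (⊥ △ (⁅ 0F ⁆ ∪ ⁅ v ⁆) ≡ ⊥ ⊎ ⊥ △ (⁅ 0F ⁆ ∪ ⁅ v ⁆) ≡ ⊤)
  neither-⊥-nor-⊤ 0F            (inj₁ eq) = true≢false (at eq 0F)
  neither-⊥-nor-⊤ (suc v)       (inj₁ eq) = true≢false (at eq 0F)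
  neither-⊥-nor-⊤ 0F            (inj₂ eq) = true≢false (sym (at eq 1F))
  neither-⊥-nor-⊤ 1F            (inj₂ eq) = true≢false (sym (at eq 2F))
  neither-⊥-nor-⊤ (suc (suc v)) (inj₂ eq) = true≢false (sym (at eq 1F))

T5-failure : ExchangeFailure T5
T5-failure = record
  { X = ⊥ ; Y = ⊤ ; u = 2F ; X-feasible = refl ; Y-feasible = refl ; u∈X△Y = refl
  ; no-exchange = λ where
      (0F , _ , ())
      (1F , _ , ())
      (2F , _ , ())
      (3F , _ , ())
  }

T6-failure : ExchangeFailure T6
T6-failure = record
  { X = ⊥ ; Y = ⊤ ; u = 3F ; X-feasible = refl ; Y-feasible = refl ; u∈X△Y = refl
  ; no-exchange = λ where
      (0F , _ , ())
      (1F , _ , ())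
      (2F , _ , ())
      (3F , _ , ())
  }

T7-failure : ExchangeFailure T7
T7-failure = record
  { X = ⊤ ; Y = ⊥ ; u = 0F ; X-feasible = refl ; Y-feasible = refl ; u∈X△Y = refl
  ; no-exchange = λ where
      (0F , _ , ())
      (1F , _ , ())
      (2F , _ , ())
      (3F , _ , ())
  }

excluded⇒failure : {M : SetSystem k} → IsoToExcluded M → ExchangeFailure M
excluded⇒failure (inj₁ (_ , s≤s (s≤s (s≤s {n = i} _)) , _ , A , M≅E)) =
  failure-iso (Iso-sym M≅E) (failure-twist A (Sys-failure i))
excluded⇒failure (inj₂ (A , inj₁ M≅E))        = failure-iso (Iso-sym M≅E) (failure-twist A T5-failure)
excluded⇒failure (inj₂ (A , inj₂ (inj₁ M≅E))) = failure-iso (Iso-sym M≅E) (failure-twist A T6-failure)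
excluded⇒failure (inj₂ (A , inj₂ (inj₂ M≅E))) = failure-iso (Iso-sym M≅E) (failure-twist A T7-failure)

deltaMatroid⇒¬excludedMinor : {S : SetSystem n} → DeltaMatroid S → ¬ HasExcludedMinor S
deltaMatroid⇒¬excludedMinor dm (_ , _ , S≽M , M-excluded) =
  deltaMatroid⇒¬failure dm (failure-minor S≽M (excluded⇒failure M-excluded))

-- Restriction to a subset

-- Subsets of K are encoded as Subset ∣ K ∣, through the increasing enumeration embed K of K.

embed : (K : Subset n) → Fin ∣ K ∣ → Fin n
embed (true ∷ K)  zero    = zero
embed (true ∷ K)  (suc p) = suc (embed K p)
embed (false ∷ K) p       = suc (embed K p)

spread : (K : Subset n) → Subset ∣ K ∣ → Subset n
spread []          []      = []
spread (true ∷ K)  (w ∷ W) = w ∷ spread K W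
spread (false ∷ K) W       = false ∷ spread K W

merge : (K X : Subset n) → Subset ∣ K ∣ → Subset n
merge []          []      []      = []
merge (true ∷ K)  (x ∷ X) (z ∷ Z) = z ∷ merge K X Z
merge (false ∷ K) (x ∷ X) Z       = x ∷ merge K X Z

compress : (K X : Subset n) → Subset ∣ K ∣
compress []          []      = []
compress (true ∷ K)  (x ∷ X) = x ∷ compress K X
compress (false ∷ K) (x ∷ X) = compress K X

merge-compress : (K X : Subset n) → merge K X (compress K X) ≡ X
merge-compress []          []      = refl
merge-compress (true ∷ K)  (x ∷ X) = cong (x ∷_) (merge-compress K X)
merge-compress (false ∷ K) (x ∷ X) = cong (x ∷_) (merge-compress K X)

merge-△-compress : (K X : Subset n) (W : Subset ∣ K ∣) → merge K X (W △ compress K X) ≡ spread K W △ X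
merge-△-compress []          []      []      = refl
merge-△-compress (true ∷ K)  (x ∷ X) (w ∷ W) = cong ((w xor x) ∷_) (merge-△-compress K X W)
merge-△-compress (false ∷ K) (x ∷ X) W       = cong (x ∷_) (merge-△-compress K X W)

spread-△ : (K : Subset n) (A B : Subset ∣ K ∣) → spread K (A △ B) ≡ spread K A △ spread K B
spread-△ []          []      []      = refl
spread-△ (true ∷ K)  (a ∷ A) (b ∷ B) = cong ((a xor b) ∷_) (spread-△ K A B)
spread-△ (false ∷ K) A       B       = cong (false ∷_) (spread-△ K A B)

spread-∪ : (K : Subset n) (A B : Subset ∣ K ∣) → spread K (A ∪ B) ≡ spread K A ∪ spread K B
spread-∪ []          []      []      = refl
spread-∪ (true ∷ K)  (a ∷ A) (b ∷ B) = cong ((a ∨ b) ∷_) (spread-∪ K A B)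
spread-∪ (false ∷ K) A       B       = cong (false ∷_) (spread-∪ K A B)

spread-⊥ : (K : Subset n) → spread K ⊥ ≡ ⊥
spread-⊥ []          = refl
spread-⊥ (true ∷ K)  = cong (false ∷_) (spread-⊥ K)
spread-⊥ (false ∷ K) = cong (false ∷_) (spread-⊥ K)

spread-⊤ : (K : Subset n) → spread K ⊤ ≡ K
spread-⊤ []          = refl
spread-⊤ (true ∷ K)  = cong (true ∷_) (spread-⊤ K)
spread-⊤ (false ∷ K) = cong (false ∷_) (spread-⊤ K)

spread-⁅⁆ : (K : Subset n) (p : Fin ∣ K ∣) → spread K ⁅ p ⁆ ≡ ⁅ embed K p ⁆
spread-⁅⁆ (true ∷ K)  zero    = cong (true ∷_) (spread-⊥ K)
spread-⁅⁆ (true ∷ K)  (suc p) = cong (false ∷_) (spread-⁅⁆ K p)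
spread-⁅⁆ (false ∷ K) p       = cong (false ∷_) (spread-⁅⁆ K p)

lookup-spread-embed : (K : Subset n) (W : Subset ∣ K ∣) (p : Fin ∣ K ∣) →
                      lookup (spread K W) (embed K p) ≡ lookup W p
lookup-spread-embed (true ∷ K)  (w ∷ W) zero    = refl
lookup-spread-embed (true ∷ K)  (w ∷ W) (suc p) = lookup-spread-embed K W p
lookup-spread-embed (false ∷ K) W       p       = lookup-spread-embed K W p

spread-support : (K : Subset n) (W : Subset ∣ K ∣) (v : Fin n) → lookup (spread K W) v ≡ true →
                 ∃[ p ] (embed K p ≡ v × lookup W p ≡ true)
spread-support (true ∷ K)  (w ∷ W) zero    v∈ = zero , refl , v∈
spread-support (true ∷ K)  (w ∷ W) (suc v) v∈ with spread-support K W v v∈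
... | p , refl , p∈ = suc p , refl , p∈
spread-support (false ∷ K) W       (suc v) v∈ with spread-support K W v v∈
... | p , refl , p∈ = p , refl , p∈

∣spread∣ : (K : Subset n) (W : Subset ∣ K ∣) → ∣ spread K W ∣ ≡ ∣ W ∣
∣spread∣ []          []          = refl
∣spread∣ (true ∷ K)  (true ∷ W)  = cong suc (∣spread∣ K W)
∣spread∣ (true ∷ K)  (false ∷ W) = ∣spread∣ K W
∣spread∣ (false ∷ K) W           = ∣spread∣ K W

parity-spread : (K : Subset n) (W : Subset ∣ K ∣) → parity (spread K W) ≡ parity W
parity-spread []          []      = refl
parity-spread (true ∷ K)  (w ∷ W) = cong (w xor_) (parity-spread K W)
parity-spread (false ∷ K) W       = parity-spread K W

embed∈ : (K : Subset n) (p : Fin ∣ K ∣) → lookup K (embed K p) ≡ true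
embed∈ K p = begin
  lookup K (embed K p)            ≡⟨ cong (λ L → lookup L (embed K p)) (spread-⊤ K) ⟨
  lookup (spread K ⊤) (embed K p) ≡⟨ lookup-spread-embed K ⊤ p ⟩
  lookup ⊤ p                      ≡⟨ lookup-⊤ p ⟩
  true                            ∎
  where open ≡-Reasoning

∈⇒embed : (K : Subset n) {u : Fin n} → lookup K u ≡ true → ∃[ a ] embed K a ≡ u
∈⇒embed K {u} u∈K with spread-support K ⊤ u (trans (cong (λ L → lookup L u) (spread-⊤ K)) u∈K)
... | a , a↦u , _ = a , a↦u

spread-pair : (K : Subset n) (p q : Fin ∣ K ∣) → spread K (⁅ p ⁆ ∪ ⁅ q ⁆) ≡ ⁅ embed K p ⁆ ∪ ⁅ embed K q ⁆
spread-pair K p q = trans (spread-∪ K ⁅ p ⁆ ⁅ q ⁆) (cong₂ _∪_ (spread-⁅⁆ K p) (spread-⁅⁆ K q))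

spread-exchanged : (K : Subset n) (W : Subset ∣ K ∣) (p q : Fin ∣ K ∣) →
                   spread K (W △ (⁅ p ⁆ ∪ ⁅ q ⁆)) ≡ spread K W △ (⁅ embed K p ⁆ ∪ ⁅ embed K q ⁆)
spread-exchanged K W p q = trans (spread-△ K W _) (cong (spread K W △_) (spread-pair K p q))

-- Each entry removes one element: its position, and whether it is contracted (true) or deleted.
data Removals : ℕ → ℕ → Set where
  []  : Removals n n
  _∷_ : Fin (suc n) × Bool → Removals n k → Removals (suc n) k

reinsert : Removals n k → Subset k → Subset n
reinsert []            Z = Z
reinsert ((e , b) ∷ ρ) Z = insertAt (reinsert ρ Z) e b

removeAll : Removals n k → SetSystem n → SetSystem k
removeAll []            S = S
removeAll ((e , b) ∷ ρ) S = removeAll ρ (λ Z → S (insertAt Z e b))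

removeAll-reinsert : (ρ : Removals n k) (S : SetSystem n) (Z : Subset k) →
                     removeAll ρ S Z ≡ S (reinsert ρ Z)
removeAll-reinsert []            S Z = refl
removeAll-reinsert ((e , b) ∷ ρ) S Z = removeAll-reinsert ρ (λ Z → S (insertAt Z e b)) Z

removeAll-minor : (ρ : Removals n k) {S : SetSystem n} {Z : Subset k} →
                  Feasible S (reinsert ρ Z) → Minor S (removeAll ρ S)
removeAll-minor []                {Z = Z} _        = here
removeAll-minor ((e , true) ∷ ρ)  {Z = Z} feasible =
  step (contract e λ loop → loop _ feasible (lookup⇒[]= e _ (insertAt-lookup (reinsert ρ Z) e true)))
       (removeAll-minor ρ feasible)
removeAll-minor ((e , false) ∷ ρ) {Z = Z} feasible =
  step (delete e λ coloop → true≢false (trans (sym ([]=⇒lookup (coloop _ feasible)))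
                                              (insertAt-lookup (reinsert ρ Z) e false)))
       (removeAll-minor ρ feasible)

lift : Removals n k → Removals (suc n) (suc k)
lift []            = []
lift ((e , b) ∷ ρ) = (suc e , b) ∷ lift ρ

reinsert-lift : (ρ : Removals n k) (z : Bool) (Z : Subset k) → reinsert (lift ρ) (z ∷ Z) ≡ z ∷ reinsert ρ Z
reinsert-lift []            z Z = refl
reinsert-lift ((e , b) ∷ ρ) z Z = cong (λ W → insertAt W (suc e) b) (reinsert-lift ρ z Z)

removalsOutside : (K X : Subset n) → Removals n ∣ K ∣
removalsOutside []          []      = []
removalsOutside (true ∷ K)  (x ∷ X) = lift (removalsOutside K X)
removalsOutside (false ∷ K) (x ∷ X) = (zero , x) ∷ removalsOutside K X

reinsert-removalsOutside : (K X : Subset n) (Z : Subset ∣ K ∣) → reinsert (removalsOutside K X) Z ≡ merge K X Z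
reinsert-removalsOutside []          []      []      = refl
reinsert-removalsOutside (true ∷ K)  (x ∷ X) (z ∷ Z) =
  trans (reinsert-lift (removalsOutside K X) z Z) (cong (z ∷_) (reinsert-removalsOutside K X Z))
reinsert-removalsOutside (false ∷ K) (x ∷ X) Z       = cong (x ∷_) (reinsert-removalsOutside K X Z)

-- Contract the elements of X outside K, delete the other elements outside K.
restrict : SetSystem n → (K X : Subset n) → SetSystem ∣ K ∣
restrict S K X = removeAll (removalsOutside K X) S

restrict-merge : (S : SetSystem n) (K X : Subset n) (Z : Subset ∣ K ∣) →
                 restrict S K X Z ≡ S (merge K X Z)
restrict-merge S K X Z =
  trans (removeAll-reinsert (removalsOutside K X) S Z) (cong S (reinsert-removalsOutside K X Z))

restrict-minor : {S : SetSystem n} (K : Subset n) {X : Subset n} → Feasible S X → Minor S (restrict S K X)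
restrict-minor {S = S} K {X} feasible = removeAll-minor (removalsOutside K X) {Z = compress K X}
  (subst (Feasible S) (sym (trans (reinsert-removalsOutside K X _) (merge-compress K X))) feasible)

twist-restrict : (S : SetSystem n) (K X : Subset n) (W : Subset ∣ K ∣) →
                 twist (restrict S K X) (compress K X) W ≡ twist S X (spread K W)
twist-restrict S K X W = trans (restrict-merge S K X _) (cong S (merge-△-compress K X W))

Minor-trans : {S : SetSystem m} {T : SetSystem k} {U : SetSystem n} → Minor S T → Minor T U → Minor S U
Minor-trans here            T≽U = T≽U
Minor-trans (step s S′≽T)   T≽U = step s (Minor-trans S′≽T T≽U)

excludedMinor-minor : {S : SetSystem m} {M : SetSystem k} → Minor S M → HasExcludedMinor M → HasExcludedMinor S
excludedMinor-minor S≽M (_ , N , M≽N , N-excluded) = _ , N , Minor-trans S≽M M≽N , N-excluded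

excludedMinor-restrict : {S : SetSystem n} (K : Subset n) {X : Subset n} → Feasible S X →
                         IsoToExcluded (twist S X ∘ spread K) → HasExcludedMinor S
excludedMinor-restrict {S = S} K {X} feasible excluded =
  _ , restrict S K X , restrict-minor K feasible ,
  excluded-untwist (compress K X) (excluded-≗ (twist-restrict S K X) excluded)

-- Exchange for pairs at small distance

ExchangeBelow : ℕ → SetSystem n → Set
ExchangeBelow {n} d S = ∀ (X Y : Subset n) → ∣ X △ Y ∣ < d → Feasible S X → Feasible S Y →
                        ∀ u → lookup (X △ Y) u ≡ true → Exchange S X Y u

exchangeBelow-twist : ∀ {d} {S : SetSystem n} (A : Subset n) → ExchangeBelow d S → ExchangeBelow d (twist S A)
exchangeBelow-twist {d = d} {S} A exchange X Y close fX fY u u∈ =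
  exchange-twist⁺ S A (exchange (X △ A) (Y △ A) (subst (λ D → ∣ D ∣ < d) (sym diff) close) fX fY u
                                (subst (λ D → lookup D u ≡ true) (sym diff) u∈))
  where diff = △-cancel-common X Y A

exchangeBelow-spread : ∀ {d} {S : SetSystem n} (K : Subset n) → ExchangeBelow d S → ExchangeBelow d (S ∘ spread K)
exchangeBelow-spread {d = d} {S} K exchange W₁ W₂ close f₁ f₂ p p∈
  with exchange (spread K W₁) (spread K W₂) (subst (_< d) (sym ∣diff∣) close) f₁ f₂ (embed K p)
         (trans (cong (λ D → lookup D (embed K p)) (sym (spread-△ K W₁ W₂)))
                (trans (lookup-spread-embed K _ p) p∈))
  where
  ∣diff∣ : ∣ spread K W₁ △ spread K W₂ ∣ ≡ ∣ W₁ △ W₂ ∣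
  ∣diff∣ = trans (cong ∣_∣ (sym (spread-△ K W₁ W₂))) (∣spread∣ K (W₁ △ W₂))
... | v , v∈ , feasible
  with spread-support K (W₁ △ W₂) v (subst (λ D → lookup D v ≡ true) (sym (spread-△ K W₁ W₂)) v∈)
...   | q , refl , q∈ = q , q∈ , subst (Feasible S) (sym (spread-exchanged K W₁ p q)) feasible

-- A minimal exchange failure at X, Y, u becomes one of these after twisting by X and
-- restricting to X △ Y.
record NormalisedFailure (R : SetSystem n) (u : Fin n) : Set where
  field
    ⊥-feasible : Feasible R ⊥
    ⊤-feasible : Feasible R ⊤
    even       : ∀ {W} → Feasible R W → parity W ≡ false
    stuck      : ∀ v → ¬ Feasible R (⁅ u ⁆ ∪ ⁅ v ⁆)

failure-normalise : {S : SetSystem n} → EvenSS S → (f : ExchangeFailure S) → let open ExchangeFailure f in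
                    {u′ : Fin ∣ X △ Y ∣} → embed (X △ Y) u′ ≡ u →
                    NormalisedFailure (twist S X ∘ spread (X △ Y)) u′
failure-normalise {S = S} even f {u′} u′↦u = record
  { ⊥-feasible = subst (Feasible S) (sym (trans (cong (_△ X) (spread-⊥ D)) (△-identityˡ X))) X-feasible
  ; ⊤-feasible = subst (Feasible S) (sym (trans (cong (_△ X) (spread-⊤ D)) (△-cancelˡ X Y))) Y-feasible
  ; even       = λ {W} fW → trans (sym (parity-spread D W)) (twist-even even X-feasible fW)
  ; stuck      = λ v fv → no-exchange (embed D v , embed∈ D v , subst (Feasible S) (pair≡ v) fv)
  }
  where
  open ExchangeFailure f
  D = X △ Y
  pair≡ : ∀ v → spread D (⁅ u′ ⁆ ∪ ⁅ v ⁆) △ X ≡ X △ (⁅ u ⁆ ∪ ⁅ embed D v ⁆)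
  pair≡ v = trans (cong (_△ X) (trans (spread-pair D u′ v) (cong (λ w → ⁅ w ⁆ ∪ _) u′↦u))) (△-comm _ X)

normalisedFailure-3≤ : {R : SetSystem n} {u : Fin n} → NormalisedFailure R u → 3 ≤ n
normalisedFailure-3≤ {1}                 {u = 0F} nf = ⊥-elim (true≢false (even ⊤-feasible))
  where open NormalisedFailure nf
normalisedFailure-3≤ {2}                 {u = 0F} nf = ⊥-elim (stuck 1F ⊤-feasible)
  where open NormalisedFailure nf
normalisedFailure-3≤ {2}                 {u = 1F} nf = ⊥-elim (stuck 0F ⊤-feasible)
  where open NormalisedFailure nf
normalisedFailure-3≤ {suc (suc (suc _))}          _  = s≤s (s≤s (s≤s z≤n))

normalisedFailure-2∣ : {R : SetSystem n} {u : Fin n} → NormalisedFailure R u → 2 ∣ℕ n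
normalisedFailure-2∣ {n} nf = parityℕ≡false⇒2∣ n (begin
  parityℕ n        ≡⟨ cong parityℕ (∣⊤∣≡n n) ⟨
  parityℕ ∣ ⊤ {n} ∣ ≡⟨ parity≡parityℕ∣∣ (⊤ {n}) ⟨
  parity (⊤ {n})   ≡⟨ even ⊤-feasible ⟩
  false            ∎)
  where open NormalisedFailure nf
        open ≡-Reasoning

Intermediate : SetSystem n → Subset n → Set
Intermediate R W = Feasible R W × W ≢ ⊥ × W ≢ ⊤

intermediate? : (R : SetSystem n) (W : Subset n) → Dec (Intermediate R W)
intermediate? R W = (R W Bool.≟ true) ×-dec (¬? (≡-dec Bool._≟_ W ⊥) ×-dec ¬? (≡-dec Bool._≟_ W ⊤))

no-intermediate⇒Sys : {R : SetSystem n} {u : Fin n} → NormalisedFailure R u →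
                      (∀ W → ¬ Intermediate R W) → ∀ W → R W ≡ Sys n W
no-intermediate⇒Sys nf none W with ≡-dec Bool._≟_ W ⊥ | ≡-dec Bool._≟_ W ⊤
... | yes refl | _        = ⊥-feasible where open NormalisedFailure nf
... | no _     | yes refl = ⊤-feasible where open NormalisedFailure nf
... | no W≢⊥   | no W≢⊤   = Bool.¬-not λ fW → none W (fW , W≢⊥ , W≢⊤)

module _ {R : SetSystem n} {u : Fin n} (nf : NormalisedFailure R u) (exchange : ExchangeBelow n R) where
  open NormalisedFailure nf

  intermediate⇒pair : ∀ {W} → Intermediate R W →
                      Σ[ p ∈ Fin n ] Σ[ q ∈ Fin n ] (p ≢ q × u ≢ p × u ≢ q × Feasible R (⁅ p ⁆ ∪ ⁅ q ⁆))
  intermediate⇒pair {W} (fW , W≢⊥ , W≢⊤) with ≢⊥⇒element W≢⊥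
  ... | p , p∈W
    with exchange ⊥ W (subst (λ V → ∣ V ∣ < n) (sym (△-identityˡ W)) (≢⊤⇒∣∣< W≢⊤)) ⊥-feasible fW p
                  (trans (cong (λ V → lookup V p) (△-identityˡ W)) p∈W)
  ...   | q , _ , f⊥△pq = p , q , p≢q , u≢p , u≢q , fpq
    where
    fpq : Feasible R (⁅ p ⁆ ∪ ⁅ q ⁆)
    fpq = subst (Feasible R) (△-identityˡ _) f⊥△pq
    p≢q : p ≢ q
    p≢q refl = true≢false (trans (sym (parity-⁅⁆∪⁅⁆ p)) (even fpq))
    u≢p : u ≢ p
    u≢p refl = stuck q fpq
    u≢q : u ≢ q
    u≢q refl = stuck p (subst (Feasible R) (∪-comm ⁅ p ⁆ ⁅ u ⁆) fpq)

  module _ {p q : Fin n} (p≢q : p ≢ q) (u≢p : u ≢ p) (u≢q : u ≢ q) (fpq : Feasible R (⁅ p ⁆ ∪ ⁅ q ⁆)) where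
    private
      P : Subset n
      P = ⁅ p ⁆ △ ⁅ q ⁆
      fP : Feasible R P
      fP = subst (Feasible R) (⁅⁆∪⁅⁆≡⁅⁆△⁅⁆ p≢q) fpq
      p∈P : lookup P p ≡ true
      p∈P = trans (lookup-△ ⁅ p ⁆ ⁅ q ⁆ p) (cong₂ _xor_ (lookup-⁅⁆-self p) (lookup-⁅⁆-≢ (p≢q ∘ sym)))
      u∉P : lookup P u ≡ false
      u∉P = ∉-△ ⁅ p ⁆ ⁅ q ⁆ (lookup-⁅⁆-≢ (u≢p ∘ sym)) (lookup-⁅⁆-≢ (u≢q ∘ sym))

    pair⇒four-set : ∃[ K ] (lookup K u ≡ true × ∣ K ∣ ≡ 4 × Feasible R K)
    pair⇒four-set
      with exchange P ⊤ (∉⇒∣∣< (P △ ⊤) (trans (lookup-△-⊤ P p) (cong not p∈P))) fP ⊤-feasible u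
                    (trans (lookup-△-⊤ P u) (cong not u∉P))
    ... | r , r∈P△⊤ , fP△ur = P △ (⁅ u ⁆ △ ⁅ r ⁆) , u∈K , ∣K∣≡4 , fK
      where
      open ≡-Reasoning
      r∉P : lookup P r ≡ false
      r∉P = trans (sym (not-involutive _)) (cong not (trans (sym (lookup-△-⊤ P r)) r∈P△⊤))
      u≢r : u ≢ r
      u≢r refl = true≢false (trans (sym (trans (parity-△ P _) (cong₂ _xor_ (even fP) (parity-⁅⁆∪⁅⁆ u))))
                                   (even fP△ur))
      fK : Feasible R (P △ (⁅ u ⁆ △ ⁅ r ⁆))
      fK = subst (Feasible R) (cong (P △_) (⁅⁆∪⁅⁆≡⁅⁆△⁅⁆ u≢r)) fP△ur
      u∈K : lookup (P △ (⁅ u ⁆ △ ⁅ r ⁆)) u ≡ true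
      u∈K = trans (lookup-△ P _ u) (cong₂ _xor_ u∉P
              (trans (lookup-△ ⁅ u ⁆ ⁅ r ⁆ u) (cong₂ _xor_ (lookup-⁅⁆-self u) (lookup-⁅⁆-≢ (u≢r ∘ sym)))))
      ∣K∣≡4 : ∣ P △ (⁅ u ⁆ △ ⁅ r ⁆) ∣ ≡ 4
      ∣K∣≡4 = begin
        ∣ P △ (⁅ u ⁆ △ ⁅ r ⁆) ∣        ≡⟨ cong ∣_∣ (△-assoc P ⁅ u ⁆ ⁅ r ⁆) ⟨
        ∣ (P △ ⁅ u ⁆) △ ⁅ r ⁆ ∣        ≡⟨ ∣△⁅⁆∣ (P △ ⁅ u ⁆) r (∉-△ P ⁅ u ⁆ r∉P (lookup-⁅⁆-≢ u≢r)) ⟩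
        suc ∣ P △ ⁅ u ⁆ ∣              ≡⟨ cong suc (∣△⁅⁆∣ P u u∉P) ⟩
        suc (suc ∣ ⁅ p ⁆ △ ⁅ q ⁆ ∣)    ≡⟨ cong (2 ℕ.+_) (∣△⁅⁆∣ ⁅ p ⁆ q (lookup-⁅⁆-≢ p≢q)) ⟩
        suc (suc (suc ∣ ⁅ p ⁆ ∣))      ≡⟨ cong (3 ℕ.+_) (∣⁅x⁆∣≡1 p) ⟩
        4                              ∎

  intermediate⇒four-set : ∀ {W} → Intermediate R W → ∃[ K ] (lookup K u ≡ true × ∣ K ∣ ≡ 4 × Feasible R K)
  intermediate⇒four-set W-intermediate with intermediate⇒pair W-intermediate
  ... | _ , _ , p≢q , u≢p , u≢q , fpq = pair⇒four-set p≢q u≢p u≢q fpq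

normalisedFailure-spread : {R : SetSystem n} (K : Subset n) {a : Fin ∣ K ∣} →
                           NormalisedFailure R (embed K a) → Feasible R K → NormalisedFailure (R ∘ spread K) a
normalisedFailure-spread {R = R} K {a} nf fK = record
  { ⊥-feasible = subst (Feasible R) (sym (spread-⊥ K)) ⊥-feasible
  ; ⊤-feasible = subst (Feasible R) (sym (spread-⊤ K)) fK
  ; even       = λ {W} fW → trans (sym (parity-spread K W)) (even fW)
  ; stuck      = λ v → stuck (embed K v) ∘ subst (Feasible R) (spread-pair K a v)
  }
  where open NormalisedFailure nf

normalisedFailure-iso : {S : SetSystem m} {T : SetSystem k} {a : Fin k} →
                        (S≅T : Iso S T) → NormalisedFailure T a → NormalisedFailure S (proj₁ S≅T ⟨$⟩ˡ a)
normalisedFailure-iso {T = T} {a} (φ , S≡T∘φ) nf = record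
  { ⊥-feasible = trans (S≡T∘φ ⊥) (subst (Feasible T) (sym (image-⊥ φ)) ⊥-feasible)
  ; ⊤-feasible = trans (S≡T∘φ ⊤) (subst (Feasible T) (sym (image-⊤ φ)) ⊤-feasible)
  ; even       = λ {W} fW → trans (sym (parity-image φ W)) (even (trans (sym (S≡T∘φ W)) fW))
  ; stuck      = λ v fv → stuck (φ ⟨$⟩ʳ v) (subst (Feasible T) (pair≡ v) (trans (sym (S≡T∘φ _)) fv))
  }
  where
  open NormalisedFailure nf
  pair≡ : ∀ v → image φ (⁅ φ ⟨$⟩ˡ a ⁆ ∪ ⁅ v ⁆) ≡ ⁅ a ⁆ ∪ ⁅ φ ⟨$⟩ʳ v ⁆
  pair≡ v = trans (image-pair φ _ v) (cong (λ b → ⁅ b ⁆ ∪ ⁅ φ ⟨$⟩ʳ v ⁆) (Perm.inverseʳ φ))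

-- Normalised failures on four elements

table : Bool → Bool → Bool → SetSystem 4
table _   _   _   (false ∷ false ∷ false ∷ false ∷ []) = true
table b₁₂ _   _   (false ∷ true  ∷ true  ∷ false ∷ []) = b₁₂
table _   b₁₃ _   (false ∷ true  ∷ false ∷ true  ∷ []) = b₁₃
table _   _   b₂₃ (false ∷ false ∷ true  ∷ true  ∷ []) = b₂₃
table _   _   _   (true  ∷ true  ∷ true  ∷ true  ∷ []) = true
table _   _   _   _                                    = false

normalisedFailure-table : {R : SetSystem 4} → NormalisedFailure R 0F →
                          ∀ W → R W ≡ table (R (⁅ 1F ⁆ ∪ ⁅ 2F ⁆)) (R (⁅ 1F ⁆ ∪ ⁅ 3F ⁆)) (R (⁅ 2F ⁆ ∪ ⁅ 3F ⁆)) W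
normalisedFailure-table {R} nf = λ where
    (false ∷ false ∷ false ∷ false ∷ []) → ⊥-feasible
    (false ∷ false ∷ false ∷ true  ∷ []) → odd refl
    (false ∷ false ∷ true  ∷ false ∷ []) → odd refl
    (false ∷ false ∷ true  ∷ true  ∷ []) → refl
    (false ∷ true  ∷ false ∷ false ∷ []) → odd refl
    (false ∷ true  ∷ false ∷ true  ∷ []) → refl
    (false ∷ true  ∷ true  ∷ false ∷ []) → refl
    (false ∷ true  ∷ true  ∷ true  ∷ []) → odd refl
    (true  ∷ false ∷ false ∷ false ∷ []) → odd refl
    (true  ∷ false ∷ false ∷ true  ∷ []) → Bool.¬-not (stuck 3F)
    (true  ∷ false ∷ true  ∷ false ∷ []) → Bool.¬-not (stuck 2F)
    (true  ∷ false ∷ true  ∷ true  ∷ []) → odd refl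
    (true  ∷ true  ∷ false ∷ false ∷ []) → Bool.¬-not (stuck 1F)
    (true  ∷ true  ∷ false ∷ true  ∷ []) → odd refl
    (true  ∷ true  ∷ true  ∷ false ∷ []) → odd refl
    (true  ∷ true  ∷ true  ∷ true  ∷ []) → ⊤-feasible
  where
  open NormalisedFailure nf
  odd : ∀ {W} → parity W ≡ true → R W ≡ false
  odd odd-W = Bool.¬-not λ fW → true≢false (trans (sym odd-W) (even fW))

private
  allSubsets? : {P : Subset n → Set} → (∀ W → Dec (P W)) → Dec (∀ W → P W)
  allSubsets? {zero}  P? = map′ (λ P[] → λ { [] → P[] }) (λ ∀P → ∀P []) (P? [])
  allSubsets? {suc n} P? =
    map′ (λ (∀P-in , ∀P-out) → λ { (true ∷ W) → ∀P-in W ; (false ∷ W) → ∀P-out W })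
         (λ ∀P → ∀P ∘ (true ∷_) , ∀P ∘ (false ∷_))
         (allSubsets? (P? ∘ (true ∷_)) ×-dec allSubsets? (P? ∘ (false ∷_)))

  iso-by-computation : (S T : SetSystem n) (π : Permutation n n) →
                       {True (allSubsets? λ W → S W Bool.≟ T (image π W))} → Iso S T
  iso-by-computation S T π {S≅T} = π , toWitness S≅T

-- The pairs of twist T5 ⊤ are {2,3}, those of twist T6 ⊤ are {1,3} and {2,3}, and twist T7 ⊤
-- has all three; each transposition moves the pairs of the table onto these.
table-excluded : ∀ b₁₂ b₁₃ b₂₃ → IsoToExcluded (table b₁₂ b₁₃ b₂₃)
table-excluded false false false =
  excluded-iso (iso-by-computation _ (Sys 4) Perm.id) (Sys-excluded (s≤s (s≤s (s≤s z≤n))) (divides 2 refl))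
table-excluded false false true  = inj₂ (⊤ , inj₁ (iso-by-computation _ (twist T5 ⊤) Perm.id))
table-excluded false true  false = inj₂ (⊤ , inj₁ (iso-by-computation _ (twist T5 ⊤) (Perm.transpose 1F 2F)))
table-excluded true  false false = inj₂ (⊤ , inj₁ (iso-by-computation _ (twist T5 ⊤) (Perm.transpose 1F 3F)))
table-excluded false true  true  = inj₂ (⊤ , inj₂ (inj₁ (iso-by-computation _ (twist T6 ⊤) Perm.id)))
table-excluded true  true  false = inj₂ (⊤ , inj₂ (inj₁ (iso-by-computation _ (twist T6 ⊤) (Perm.transpose 1F 3F))))
table-excluded true  false true  = inj₂ (⊤ , inj₂ (inj₁ (iso-by-computation _ (twist T6 ⊤) (Perm.transpose 2F 3F))))
table-excluded true  true  true  = inj₂ (⊤ , inj₂ (inj₂ (iso-by-computation _ (twist T7 ⊤) Perm.id)))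

transpose-from : (i j : Fin n) → Perm.transpose i j ⟨$⟩ˡ j ≡ i
transpose-from i j rewrite dec-true (j ≟ j) refl = refl

normalisedFailure₄-excluded : {R : SetSystem k} {a : Fin k} → k ≡ 4 → NormalisedFailure R a → IsoToExcluded R
normalisedFailure₄-excluded {R = R} {a} refl nf =
  excluded-iso (Iso-sym R∘τ≅R) (excluded-≗ (normalisedFailure-table nf₀) (table-excluded _ _ _))
  where
  τ = Perm.transpose 0F a
  R∘τ≅R : Iso (λ W → R (image τ W)) R
  R∘τ≅R = τ , λ _ → refl
  nf₀ : NormalisedFailure (λ W → R (image τ W)) 0F
  nf₀ = subst (NormalisedFailure _) (transpose-from 0F a) (normalisedFailure-iso R∘τ≅R nf)

-- Minimal exchange failures yield excluded minors

module _ {S : SetSystem n} (even : EvenSS S) (f : ExchangeFailure S) where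
  open ExchangeFailure f

  private
    D : Subset n
    D = X △ Y
    R : SetSystem ∣ D ∣
    R = twist S X ∘ spread D
    u′ : Fin ∣ D ∣
    u′ = proj₁ (∈⇒embed D u∈X△Y)
    nf : NormalisedFailure R u′
    nf = failure-normalise even f (proj₂ (∈⇒embed D u∈X△Y))

    no-intermediate⇒excludedMinor : (∀ W → ¬ Intermediate R W) → HasExcludedMinor S
    no-intermediate⇒excludedMinor none =
      excludedMinor-restrict D X-feasible
        (excluded-≗ (no-intermediate⇒Sys nf none)
                    (Sys-excluded (normalisedFailure-3≤ nf) (normalisedFailure-2∣ nf)))

    four-set⇒excludedMinor : ∃[ K ] (lookup K u′ ≡ true × ∣ K ∣ ≡ 4 × Feasible R K) → HasExcludedMinor S
    four-set⇒excludedMinor (K , u′∈K , ∣K∣≡4 , fK) =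
      excludedMinor-minor (restrict-minor D X-feasible)
        (excludedMinor-restrict K X′-feasible
          (excluded-≗ (twist-restrict S D X ∘ spread K) (normalisedFailure₄-excluded ∣K∣≡4 nf₄)))
      where
      X′-feasible : Feasible (restrict S D X) (compress D X)
      X′-feasible = trans (restrict-merge S D X _) (trans (cong S (merge-compress D X)) X-feasible)
      a↦u′ = proj₂ (∈⇒embed K u′∈K)
      nf₄ = normalisedFailure-spread K (subst (NormalisedFailure R) (sym a↦u′) nf) fK

  minimalFailure⇒excludedMinor : ExchangeBelow ∣ D ∣ S → HasExcludedMinor S
  minimalFailure⇒excludedMinor exchange with anySubset? (intermediate? R)
  ... | no none         = no-intermediate⇒excludedMinor λ W W-int → none (W , W-int)
  ... | yes (_ , W-int) =
    four-set⇒excludedMinor (intermediate⇒four-set nf (exchangeBelow-spread D (exchangeBelow-twist X exchange)) W-int)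

exchangeBelow-all : {S : SetSystem n} → EvenSS S → ¬ HasExcludedMinor S → ∀ d → ExchangeBelow d S
exchangeBelow-all even no-minor zero X Y ()
exchangeBelow-all {S = S} even no-minor (suc d) X Y close fX fY u u∈ with exchange? S X Y u
... | yes exchanges  = exchanges
... | no no-exchange = ⊥-elim (no-minor (minimalFailure⇒excludedMinor even failure λ X′ Y′ closer →
        exchangeBelow-all even no-minor d X′ Y′ (<-≤-trans closer (≤-pred close))))
  where
  failure : ExchangeFailure S
  failure = record { X = X ; Y = Y ; u = u ; X-feasible = fX ; Y-feasible = fY
                   ; u∈X△Y = u∈ ; no-exchange = no-exchange }

corollary5p2 : ∀ {n : ℕ} (S : SetSystem n) → Proper S → EvenSS S →
    (EvenDeltaMatroid S ⇔ (¬ HasExcludedMinor S))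
corollary5p2 S proper even = mk⇔
  (λ (deltaMatroid , _) → deltaMatroid⇒¬excludedMinor deltaMatroid)
  (λ no-minor → (proper , λ X Y fX fY u u∈ → Equivalence.to (exchange⇔∃∈ S u)
     (exchangeBelow-all even no-minor _ X Y (n<1+n _) fX fY u ([]=⇒lookup u∈))) , even)
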